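{- Let $n\geq 2$ and let $a$ be a positive integer. Then for every integer $b$ with $\lceil a/2\rceil \leq b \leq a$, the sequence $(h_0,\ldots,h_n)\in \mathbb{Z}_{>0}^{n+1}$ with $h_0=1$, $h_1=\cdots=h_{n-1}=a$ and $h_n=b$ is a pure $O$-sequence.
   Context: Monomials are in finitely many indeterminates $x_1,\ldots,x_s$ (any $s$), each of degree $1$. An order ideal of monomials is a nonempty finite set $\mathcal{A}$ of monomials such that whenever $u\in\mathcal{A}$ and $v$ is a monomial dividing $u$, then $v\in\mathcal{A}$. It is pure if all its maximal elements with respect to divisibility have the same degree. Its $h$-vector is $h(\mathcal{A})=(h_0,\ldots,h_n)$ where $n=\max\{\deg u: u\in\mathcal{A}\}$ and $h_i$ is the number of elements of $\mathcal{A}$ of degree $i$. A finite sequence of positive integers is a pure $O$-sequence if it equals $h(\mathcal{A})$ for some pure order ideal of monomials $\mathcal{A}$. -}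

module Defs where

open import Data.Nat using (ℕ; _≤_; _≟_; _⊔_)
open import Data.Vec using (Vec)
open import Data.Vec.Relation.Binary.Pointwise.Inductive using (Pointwise)
open import Data.List using (List; []; foldr; map; length; filter; upTo; _∷_)
open import Data.List.Membership.Propositional using (_∈_)
open import Data.List.Relation.Unary.Unique.Propositional using (Unique)
open import Data.Product using (Σ; _×_; ∃)
open import Relation.Binary.PropositionalEquality using (_≡_; _≢_)
import Data.Vec as V

-- A monomial in s indeterminates x₁,…,xₛ, given by its exponent vector.
Monomial : ℕ → Set
Monomial s = Vec ℕ s

deg : ∀ {s} → Monomial s → ℕ
deg u = V.sum u

_∣ᵐ_ : ∀ {s} → Monomial s → Monomial s → Set
v ∣ᵐ u = Pointwise _≤_ v u

-- A finite set of monomials is represented by a duplicate-free list.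
-- Order ideal: nonempty, finite, closed under taking divisors.
IsOrderIdeal : ∀ {s} → List (Monomial s) → Set
IsOrderIdeal {s} A =
  Unique A × (A ≢ []) ×
  (∀ (u v : Monomial s) → u ∈ A → v ∣ᵐ u → v ∈ A)

IsMaximal : ∀ {s} → List (Monomial s) → Monomial s → Set
IsMaximal {s} A u = u ∈ A × (∀ (w : Monomial s) → w ∈ A → u ∣ᵐ w → w ≡ u)

IsPure : ∀ {s} → List (Monomial s) → Set
IsPure {s} A = ∀ (u v : Monomial s) → IsMaximal A u → IsMaximal A v → deg u ≡ deg v

maxDeg : ∀ {s} → List (Monomial s) → ℕ
maxDeg A = foldr (λ u m → deg u ⊔ m) 0 A

countDeg : ∀ {s} → List (Monomial s) → ℕ → ℕ
countDeg A i = length (filter (λ u → deg u ≟ i) A)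

hVector : ∀ {s} → List (Monomial s) → List ℕ
hVector A = map (countDeg A) (upTo (Data.Nat.suc (maxDeg A)))

IsPureOSequence : List ℕ → Set
IsPureOSequence h =
  Σ ℕ λ s → Σ (List (Monomial s)) λ A → IsOrderIdeal A × IsPure A × hVector A ≡ h

-- Gluing order ideals in disjoint sets of variables along their common element 1 keeps
-- them pure of degree n when each is, and adds their h-vectors in positive degrees. The
-- divisors of xⁿ have h-vector (1,1,…,1) and those of xⁿ⁻¹y have (1,2,…,2,1); gluing
-- c = a − b copies of the latter with d = 2b − a copies of the former gives
-- (1, 2c+d, …, 2c+d, c+d) = (1, a, …, a, b), and ⌈a/2⌉ ≤ b ≤ a says exactly c, d ≥ 0.
module Submission where

open import Defs
open import Data.Nat using (ℕ; _≤_; _∸_; ⌈_/2⌉; _<_)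
open import Data.List using (List; _∷_; []; _++_; replicate)

open import Data.Nat using (zero; suc; _+_; _*_; z≤n; s≤s; s≤s⁻¹; _≟_; ⌊_/2⌋)
open import Data.Nat.Properties
open import Data.List using (map; filter; length; upTo; applyUpTo)
open import Data.List.Properties using (filter-++; filter-none; filter-accept; filter-reject; length-++; map-∘; map-cong; map-applyUpTo)
open import Data.List.Membership.Propositional using (_∈_; _∉_)
open import Data.List.Membership.Propositional.Properties using (∈-map⁺; ∈-map⁻; ∈-++⁺ˡ; ∈-++⁺ʳ; ∈-++⁻; ∈-upTo⁺; ∈-upTo⁻; ∈-filter⁻)
open import Data.List.Relation.Unary.Any using (here; there)
open import Data.List.Relation.Unary.All as All using (All)
open import Data.List.Relation.Unary.All.Properties using (All¬⇒¬Any)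
open import Data.List.Relation.Unary.Unique.Propositional using (Unique)
open import Data.List.Relation.Unary.Unique.Propositional.Properties using (map⁺; ++⁺; upTo⁺)
open import Data.List.Relation.Unary.AllPairs using ([]; _∷_)
open import Data.Vec as V using (_∷_; [])
open import Data.Vec.Properties using (sum-++; ++-injectiveˡ; ++-injectiveʳ; ∷-injectiveˡ; ∷-injectiveʳ)
import Data.Vec.Relation.Binary.Pointwise.Inductive as Pointwise
open Pointwise using (_∷_; [])
open import Data.Product using (∃-syntax; ∃₂; _×_; _,_)
open import Data.Sum using (_⊎_; inj₁; inj₂)
open import Function using (_∘_)
open import Relation.Nullary using (¬_; does; yes; no; contradiction)
open import Relation.Unary using (Decidable)
open import Data.Bool using (true; false)
open import Relation.Binary.PropositionalEquality

𝟙 : (s : ℕ) → Monomial s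
𝟙 s = V.replicate s 0

deg-𝟙 : ∀ s → deg (𝟙 s) ≡ 0
deg-𝟙 zero = refl
deg-𝟙 (suc s) = deg-𝟙 s

deg≡0⇒≡𝟙 : ∀ {s} (u : Monomial s) → deg u ≡ 0 → u ≡ 𝟙 s
deg≡0⇒≡𝟙 [] _ = refl
deg≡0⇒≡𝟙 (zero ∷ u) eq = cong (0 ∷_) (deg≡0⇒≡𝟙 u eq)

𝟙∣ᵐ : ∀ {s} (u : Monomial s) → 𝟙 s ∣ᵐ u
𝟙∣ᵐ [] = []
𝟙∣ᵐ (_ ∷ u) = z≤n ∷ 𝟙∣ᵐ u

∣ᵐ𝟙⇒≡𝟙 : ∀ {s} (v : Monomial s) → v ∣ᵐ 𝟙 s → v ≡ 𝟙 s
∣ᵐ𝟙⇒≡𝟙 [] [] = refl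
∣ᵐ𝟙⇒≡𝟙 (_ ∷ v) (z≤n ∷ v∣𝟙) = cong (0 ∷_) (∣ᵐ𝟙⇒≡𝟙 v v∣𝟙)

∣ᵐ-refl : ∀ {s} (u : Monomial s) → u ∣ᵐ u
∣ᵐ-refl u = Pointwise.refl ≤-refl

deg-++ : ∀ {k t} (u : Monomial k) (v : Monomial t) → deg (u V.++ v) ≡ deg u + deg v
deg-++ u v = sum-++ u

occurrences : ℕ → List ℕ → ℕ
occurrences i xs = length (filter (_≟ i) xs)

occurrences-∉ : ∀ {i xs} → i ∉ xs → occurrences i xs ≡ 0
occurrences-∉ {i} {xs} i∉xs =
  cong length (filter-none (_≟ i) (All.tabulate λ x∈xs x≡i → i∉xs (subst (_∈ xs) x≡i x∈xs)))

occurrences-∈ : ∀ {i xs} → Unique xs → i ∈ xs → occurrences i xs ≡ 1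
occurrences-∈ {i} {x ∷ xs} (x∉xs ∷ _) (here refl) =
  trans (cong length (filter-accept (_≟ i) refl))
        (cong suc (occurrences-∉ (All¬⇒¬Any x∉xs)))
occurrences-∈ {i} {x ∷ xs} (x∉xs ∷ unique) (there i∈xs) =
  trans (cong length (filter-reject (_≟ i) (All.lookup x∉xs i∈xs)))
        (occurrences-∈ unique i∈xs)

length-filter-∘ : ∀ {A B : Set} {P : B → Set} (P? : Decidable P) (f : A → B) xs →
                  length (filter (P? ∘ f) xs) ≡ length (filter P? (map f xs))
length-filter-∘ P? f [] = refl
length-filter-∘ P? f (x ∷ xs) with does (P? (f x))
... | true = cong suc (length-filter-∘ P? f xs)
... | false = length-filter-∘ P? f xs

countDeg≡occurrences : ∀ {s} (A : List (Monomial s)) i → countDeg A i ≡ occurrences i (map deg A)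
countDeg≡occurrences A i = length-filter-∘ (_≟ i) deg A

countDeg-++ : ∀ {s} (A B : List (Monomial s)) i → countDeg (A ++ B) i ≡ countDeg A i + countDeg B i
countDeg-++ A B i =
  trans (cong length (filter-++ (λ u → deg u ≟ i) A B)) (length-++ (filter (λ u → deg u ≟ i) A))

countDeg-map : ∀ {s t} (f : Monomial s → Monomial t) → (∀ u → deg (f u) ≡ deg u) →
               ∀ A i → countDeg (map f A) i ≡ countDeg A i
countDeg-map f deg-f A i = begin
  countDeg (map f A) i             ≡⟨ countDeg≡occurrences (map f A) i ⟩
  occurrences i (map deg (map f A)) ≡⟨ cong (occurrences i) (map-∘ A) ⟨
  occurrences i (map (deg ∘ f) A)   ≡⟨ cong (occurrences i) (map-cong deg-f A) ⟩
  occurrences i (map deg A)         ≡⟨ countDeg≡occurrences A i ⟨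
  countDeg A i                      ∎
  where open ≡-Reasoning

countDeg-none : ∀ {s} (A : List (Monomial s)) i → (∀ {u} → u ∈ A → deg u ≢ i) → countDeg A i ≡ 0
countDeg-none A i none = cong length (filter-none (λ u → deg u ≟ i) (All.tabulate none))

countDeg-witness : ∀ {s} (A : List (Monomial s)) i → 0 < countDeg A i → ∃[ u ] u ∈ A × deg u ≡ i
countDeg-witness A i pos with filter (λ u → deg u ≟ i) A | (λ {v} → ∈-filter⁻ (λ u → deg u ≟ i) {v = v} {xs = A})
... | u ∷ _ | ∈-filter = u , ∈-filter (here refl)

applyUpTo-cong : ∀ {A : Set} {f g : ℕ → A} → (∀ i → f i ≡ g i) → ∀ n → applyUpTo f n ≡ applyUpTo g n
applyUpTo-cong f≗g zero = refl
applyUpTo-cong f≗g (suc n) = cong₂ _∷_ (f≗g 0) (applyUpTo-cong (f≗g ∘ suc) n)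

maxDeg-≤ : ∀ {s} (A : List (Monomial s)) {k} → (∀ {u} → u ∈ A → deg u ≤ k) → maxDeg A ≤ k
maxDeg-≤ [] _ = z≤n
maxDeg-≤ (u ∷ A) bound = ⊔-lub (bound (here refl)) (maxDeg-≤ A (bound ∘ there))

∈⇒≤maxDeg : ∀ {s} {A : List (Monomial s)} {u} → u ∈ A → deg u ≤ maxDeg A
∈⇒≤maxDeg {A = v ∷ A} (here refl) = m≤m⊔n (deg v) (maxDeg A)
∈⇒≤maxDeg {A = v ∷ A} (there u∈A) = ≤-trans (∈⇒≤maxDeg u∈A) (m≤n⊔m (deg v) (maxDeg A))

-- N ∪ {𝟙} is a pure order ideal with all maximal elements of degree n. Leaving 𝟙 out lets
-- such sets in disjoint variables be glued along 𝟙 by concatenation (see wedge).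
record IsPuncturedPureIdeal (n : ℕ) {s} (N : List (Monomial s)) : Set where
  field
    unique    : Unique N
    deg-pos   : ∀ {u} → u ∈ N → 0 < deg u
    deg-≤     : ∀ {u} → u ∈ N → deg u ≤ n
    closed    : ∀ {u v} → u ∈ N → v ∣ᵐ u → 0 < deg v → v ∈ N
    extension : ∀ {u} → u ∈ N → deg u < n → ∃[ w ] w ∈ N × u ∣ᵐ w × w ≢ u

  𝟙∉ : 𝟙 s ∉ N
  𝟙∉ 𝟙∈N = <⇒≢ (deg-pos 𝟙∈N) (sym (deg-𝟙 s))

module Adjoin𝟙 {n s} {N : List (Monomial s)} (P : IsPuncturedPureIdeal n N) where
  open IsPuncturedPureIdeal P

  𝟙∷-isOrderIdeal : IsOrderIdeal (𝟙 s ∷ N)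
  𝟙∷-isOrderIdeal = (All.tabulate (λ { u∈N refl → 𝟙∉ u∈N }) ∷ unique) , (λ ()) , downward
    where
    downward : ∀ u v → u ∈ 𝟙 s ∷ N → v ∣ᵐ u → v ∈ 𝟙 s ∷ N
    downward u v u∈ v∣u with deg v ≟ 0
    ... | yes deg-v≡0 = here (deg≡0⇒≡𝟙 v deg-v≡0)
    downward u v (here refl) v∣𝟙 | no deg-v≢0 = contradiction (trans (cong deg (∣ᵐ𝟙⇒≡𝟙 v v∣𝟙)) (deg-𝟙 s)) deg-v≢0
    downward u v (there u∈N) v∣u | no deg-v≢0 = there (closed u∈N v∣u (n≢0⇒n>0 deg-v≢0))

  𝟙∷-deg-≤ : ∀ {u} → u ∈ 𝟙 s ∷ N → deg u ≤ n
  𝟙∷-deg-≤ (here refl) = ≤-trans (≤-reflexive (deg-𝟙 s)) z≤n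
  𝟙∷-deg-≤ (there u∈N) = deg-≤ u∈N

  module WithTop {t} (t∈N : t ∈ N) (deg-t : deg t ≡ n) where

    𝟙∷-extension : ∀ {u} → u ∈ 𝟙 s ∷ N → deg u < n → ∃[ w ] w ∈ 𝟙 s ∷ N × u ∣ᵐ w × w ≢ u
    𝟙∷-extension (here refl) _ = t , there t∈N , 𝟙∣ᵐ t , λ { refl → 𝟙∉ t∈N }
    𝟙∷-extension (there u∈N) deg-u<n with extension u∈N deg-u<n
    ... | w , w∈N , u∣w , w≢u = w , there w∈N , u∣w , w≢u

    maximal⇒deg≡n : ∀ u → IsMaximal (𝟙 s ∷ N) u → deg u ≡ n
    maximal⇒deg≡n u (u∈ , maximal) with m≤n⇒m<n∨m≡n (𝟙∷-deg-≤ u∈)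
    ... | inj₂ deg-u≡n = deg-u≡n
    ... | inj₁ deg-u<n with 𝟙∷-extension u∈ deg-u<n
    ...   | w , w∈ , u∣w , w≢u = contradiction (maximal w w∈ u∣w) w≢u

    𝟙∷-isPure : IsPure (𝟙 s ∷ N)
    𝟙∷-isPure u v u-max v-max = trans (maximal⇒deg≡n u u-max) (sym (maximal⇒deg≡n v v-max))

    𝟙∷-maxDeg : maxDeg (𝟙 s ∷ N) ≡ n
    𝟙∷-maxDeg = ≤-antisym (maxDeg-≤ (𝟙 s ∷ N) 𝟙∷-deg-≤) (subst (_≤ _) deg-t (∈⇒≤maxDeg {A = 𝟙 s ∷ N} (there t∈N)))

    𝟙∷-hVector : hVector (𝟙 s ∷ N) ≡ 1 ∷ applyUpTo (countDeg N ∘ suc) n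
    𝟙∷-hVector = begin
      map (countDeg (𝟙 s ∷ N)) (upTo (suc (maxDeg (𝟙 s ∷ N))))
        ≡⟨ cong (λ m → map (countDeg (𝟙 s ∷ N)) (upTo (suc m))) 𝟙∷-maxDeg ⟩
      countDeg (𝟙 s ∷ N) 0 ∷ map (countDeg (𝟙 s ∷ N)) (applyUpTo suc n)
        ≡⟨ cong₂ _∷_ count-0 (map-applyUpTo suc (countDeg (𝟙 s ∷ N)) n) ⟩
      1 ∷ applyUpTo (countDeg (𝟙 s ∷ N) ∘ suc) n
        ≡⟨ cong (1 ∷_) (applyUpTo-cong count-suc n) ⟩
      1 ∷ applyUpTo (countDeg N ∘ suc) n
        ∎
      where
      open ≡-Reasoning
      count-0 : countDeg (𝟙 s ∷ N) 0 ≡ 1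
      count-0 = trans (cong length (filter-accept (λ u → deg u ≟ 0) {𝟙 s} {N} (deg-𝟙 s)))
                      (cong suc (countDeg-none N 0 λ u∈N → >⇒≢ (deg-pos u∈N)))
      count-suc : ∀ i → countDeg (𝟙 s ∷ N) (suc i) ≡ countDeg N (suc i)
      count-suc i = cong length (filter-reject (λ u → deg u ≟ suc i) {𝟙 s} {N} λ eq → 0≢1+n (trans (sym (deg-𝟙 s)) eq))

isPureOSequence-𝟙∷ : ∀ {n s} {N : List (Monomial s)} → IsPuncturedPureIdeal n N → 0 < countDeg N n →
                       IsPureOSequence (1 ∷ applyUpTo (countDeg N ∘ suc) n)
isPureOSequence-𝟙∷ {n} {s} {N} P top with countDeg-witness N n top
... | t , t∈N , deg-t = s , 𝟙 s ∷ N , 𝟙∷-isOrderIdeal , 𝟙∷-isPure , 𝟙∷-hVector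
  where open Adjoin𝟙 P
        open WithTop t∈N deg-t

padʳ : ∀ {k} t → Monomial k → Monomial (k + t)
padʳ t u = u V.++ 𝟙 t

padˡ : ∀ k {t} → Monomial t → Monomial (k + t)
padˡ k u = 𝟙 k V.++ u

deg-padʳ : ∀ {k} t (u : Monomial k) → deg (padʳ t u) ≡ deg u
deg-padʳ t u = trans (deg-++ u (𝟙 t)) (trans (cong (deg u +_) (deg-𝟙 t)) (+-identityʳ (deg u)))

deg-padˡ : ∀ k {t} (u : Monomial t) → deg (padˡ k u) ≡ deg u
deg-padˡ k u = trans (deg-++ (𝟙 k) u) (cong (_+ deg u) (deg-𝟙 k))

∣ᵐ-padʳ : ∀ {k} t (u : Monomial k) w → w ∣ᵐ padʳ t u → ∃[ v ] w ≡ padʳ t v × v ∣ᵐ u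
∣ᵐ-padʳ {k} t u w w∣u with V.splitAt k w
... | w₁ , w₂ , refl with Pointwise.++⁻ w₁ u w∣u
...   | w₁∣u , w₂∣𝟙 = w₁ , cong (w₁ V.++_) (∣ᵐ𝟙⇒≡𝟙 w₂ w₂∣𝟙) , w₁∣u

∣ᵐ-padˡ : ∀ k {t} (u : Monomial t) w → w ∣ᵐ padˡ k u → ∃[ v ] w ≡ padˡ k v × v ∣ᵐ u
∣ᵐ-padˡ k u w w∣u with V.splitAt k w
... | w₁ , w₂ , refl with Pointwise.++⁻ w₁ (𝟙 k) w∣u
...   | w₁∣𝟙 , w₂∣u = w₂ , cong (V._++ w₂) (∣ᵐ𝟙⇒≡𝟙 w₁ w₁∣𝟙) , w₂∣u

wedge : ∀ {k t} → List (Monomial k) → List (Monomial t) → List (Monomial (k + t))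
wedge {k} {t} A B = map (padʳ t) A ++ map (padˡ k) B

countDeg-wedge : ∀ {k t} (A : List (Monomial k)) (B : List (Monomial t)) i →
                 countDeg (wedge A B) i ≡ countDeg A i + countDeg B i
countDeg-wedge {k} {t} A B i = trans (countDeg-++ (map (padʳ t) A) (map (padˡ k) B) i)
  (cong₂ _+_ (countDeg-map (padʳ t) (deg-padʳ t) A i) (countDeg-map (padˡ k) (deg-padˡ k) B i))

∈-wedge⁻ : ∀ {k t} (A : List (Monomial k)) (B : List (Monomial t)) {u} → u ∈ wedge A B →
           (∃[ v ] v ∈ A × u ≡ padʳ t v) ⊎ (∃[ v ] v ∈ B × u ≡ padˡ k v)
∈-wedge⁻ {k} {t} A B u∈ with ∈-++⁻ (map (padʳ t) A) u∈
... | inj₁ u∈A = inj₁ (∈-map⁻ (padʳ t) u∈A)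
... | inj₂ u∈B = inj₂ (∈-map⁻ (padˡ k) u∈B)

wedge-isPuncturedPureIdeal : ∀ {n k t} {A : List (Monomial k)} {B : List (Monomial t)} →
  IsPuncturedPureIdeal n A → IsPuncturedPureIdeal n B → IsPuncturedPureIdeal n (wedge A B)
wedge-isPuncturedPureIdeal {n} {k} {t} {A} {B} PA PB = record
  { unique = ++⁺ (map⁺ (++-injectiveˡ _ _) A.unique) (map⁺ (++-injectiveʳ (𝟙 k) (𝟙 k)) B.unique) disjoint
  ; deg-pos = deg-pos
  ; deg-≤ = deg-≤
  ; closed = closed
  ; extension = extension
  }
  where
  module A = IsPuncturedPureIdeal PA
  module B = IsPuncturedPureIdeal PB

  disjoint : ∀ {w} → ¬ (w ∈ map (padʳ t) A × w ∈ map (padˡ k) B)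
  disjoint (w∈A , w∈B) with ∈-map⁻ (padʳ t) w∈A | ∈-map⁻ (padˡ k) w∈B
  ... | u , u∈A , refl | _ , _ , eq = A.𝟙∉ (subst (_∈ A) (++-injectiveˡ u (𝟙 k) eq) u∈A)

  deg-pos : ∀ {u} → u ∈ wedge A B → 0 < deg u
  deg-pos u∈ with ∈-wedge⁻ A B u∈
  ... | inj₁ (v , v∈A , refl) = subst (0 <_) (sym (deg-padʳ t v)) (A.deg-pos v∈A)
  ... | inj₂ (v , v∈B , refl) = subst (0 <_) (sym (deg-padˡ k v)) (B.deg-pos v∈B)

  deg-≤ : ∀ {u} → u ∈ wedge A B → deg u ≤ n
  deg-≤ u∈ with ∈-wedge⁻ A B u∈
  ... | inj₁ (v , v∈A , refl) = subst (_≤ n) (sym (deg-padʳ t v)) (A.deg-≤ v∈A)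
  ... | inj₂ (v , v∈B , refl) = subst (_≤ n) (sym (deg-padˡ k v)) (B.deg-≤ v∈B)

  closed : ∀ {u w} → u ∈ wedge A B → w ∣ᵐ u → 0 < deg w → w ∈ wedge A B
  closed {w = w} u∈ w∣u deg-w>0 with ∈-wedge⁻ A B u∈
  ... | inj₁ (v , v∈A , refl) with ∣ᵐ-padʳ t v w w∣u
  ...   | x , refl , x∣v = ∈-++⁺ˡ (∈-map⁺ (padʳ t) (A.closed v∈A x∣v (subst (0 <_) (deg-padʳ t x) deg-w>0)))
  closed {w = w} u∈ w∣u deg-w>0 | inj₂ (v , v∈B , refl) with ∣ᵐ-padˡ k v w w∣u
  ...   | x , refl , x∣v = ∈-++⁺ʳ (map (padʳ t) A) (∈-map⁺ (padˡ k) (B.closed v∈B x∣v (subst (0 <_) (deg-padˡ k x) deg-w>0)))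

  extension : ∀ {u} → u ∈ wedge A B → deg u < n → ∃[ w ] w ∈ wedge A B × u ∣ᵐ w × w ≢ u
  extension u∈ deg-u<n with ∈-wedge⁻ A B u∈
  ... | inj₁ (v , v∈A , refl) with A.extension v∈A (subst (_< n) (deg-padʳ t v) deg-u<n)
  ...   | w , w∈A , v∣w , w≢v = padʳ t w , ∈-++⁺ˡ (∈-map⁺ (padʳ t) w∈A) ,
                                Pointwise.++⁺ v∣w (∣ᵐ-refl (𝟙 t)) , w≢v ∘ ++-injectiveˡ w v
  extension u∈ deg-u<n | inj₂ (v , v∈B , refl) with B.extension v∈B (subst (_< n) (deg-padˡ k v) deg-u<n)
  ...   | w , w∈B , v∣w , w≢v = padˡ k w , ∈-++⁺ʳ (map (padʳ t) A) (∈-map⁺ (padˡ k) w∈B) ,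
                                Pointwise.++⁺ (∣ᵐ-refl (𝟙 k)) v∣w , w≢v ∘ ++-injectiveʳ (𝟙 k) (𝟙 k)

[]-isPuncturedPureIdeal : ∀ {n s} → IsPuncturedPureIdeal n {s} []
[]-isPuncturedPureIdeal = record
  { unique = [] ; deg-pos = λ () ; deg-≤ = λ () ; closed = λ () ; extension = λ () }

copies : ∀ {s} r → List (Monomial s) → List (Monomial (r * s))
copies zero A = []
copies (suc r) A = wedge A (copies r A)

copies-isPuncturedPureIdeal : ∀ {n s} r {A : List (Monomial s)} →
  IsPuncturedPureIdeal n A → IsPuncturedPureIdeal n (copies r A)
copies-isPuncturedPureIdeal zero P = []-isPuncturedPureIdeal
copies-isPuncturedPureIdeal (suc r) P = wedge-isPuncturedPureIdeal P (copies-isPuncturedPureIdeal r P)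

countDeg-copies : ∀ {s} r (A : List (Monomial s)) i → countDeg (copies r A) i ≡ r * countDeg A i
countDeg-copies zero A i = refl
countDeg-copies (suc r) A i = trans (countDeg-wedge A (copies r A) i) (cong (countDeg A i +_) (countDeg-copies r A i))

occurrences-1⋯n : ∀ {n j} → j < n → occurrences (suc j) (map suc (upTo n)) ≡ 1
occurrences-1⋯n {n} j<n = occurrences-∈ (map⁺ suc-injective (upTo⁺ n)) (∈-map⁺ suc (∈-upTo⁺ j<n))

occurrences-1⋯n-beyond : ∀ {n j} → n ≤ j → occurrences (suc j) (map suc (upTo n)) ≡ 0
occurrences-1⋯n-beyond {n} {j} n≤j = occurrences-∉ λ 1+j∈ → beyond (∈-map⁻ suc 1+j∈)
  where
  beyond : ¬ (∃[ k ] k ∈ upTo n × suc j ≡ suc k)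
  beyond (k , k∈ , refl) = <⇒≱ (∈-upTo⁻ k∈) n≤j

countDeg-map-upTo : ∀ {s} (f : ℕ → Monomial s) → (∀ k → deg (f k) ≡ suc k) →
                    ∀ n i → countDeg (map f (upTo n)) i ≡ occurrences i (map suc (upTo n))
countDeg-map-upTo f deg-f n i = begin
  countDeg (map f (upTo n)) i              ≡⟨ countDeg≡occurrences (map f (upTo n)) i ⟩
  occurrences i (map deg (map f (upTo n))) ≡⟨ cong (occurrences i) (map-∘ (upTo n)) ⟨
  occurrences i (map (deg ∘ f) (upTo n))   ≡⟨ cong (occurrences i) (map-cong deg-f (upTo n)) ⟩
  occurrences i (map suc (upTo n))         ∎
  where open ≡-Reasoning

xᵏ : ℕ → Monomial 1
xᵏ k = k ∷ []

deg-xᵏ : ∀ k → deg (xᵏ k) ≡ k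
deg-xᵏ = +-identityʳ

chain : ℕ → List (Monomial 1)
chain n = map (xᵏ ∘ suc) (upTo n)

∈-chain⁺ : ∀ {n k} → k < n → xᵏ (suc k) ∈ chain n
∈-chain⁺ k<n = ∈-map⁺ (xᵏ ∘ suc) (∈-upTo⁺ k<n)

∈-chain⁻ : ∀ {n u} → u ∈ chain n → ∃[ k ] k < n × u ≡ xᵏ (suc k)
∈-chain⁻ u∈ with ∈-map⁻ (xᵏ ∘ suc) u∈
... | k , k∈ , u≡ = k , ∈-upTo⁻ k∈ , u≡

countDeg-chain : ∀ {n j} → j < n → countDeg (chain n) (suc j) ≡ 1
countDeg-chain {n} {j} j<n =
  trans (countDeg-map-upTo (xᵏ ∘ suc) (deg-xᵏ ∘ suc) n (suc j)) (occurrences-1⋯n j<n)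

chain-isPuncturedPureIdeal : ∀ n → IsPuncturedPureIdeal n (chain n)
chain-isPuncturedPureIdeal n = record
  { unique = map⁺ (suc-injective ∘ ∷-injectiveˡ) (upTo⁺ n)
  ; deg-pos = deg-pos
  ; deg-≤ = deg-≤
  ; closed = closed
  ; extension = extension
  }
  where
  deg-pos : ∀ {u} → u ∈ chain n → 0 < deg u
  deg-pos u∈ with ∈-chain⁻ u∈
  ... | k , _ , refl = s≤s z≤n

  deg-≤ : ∀ {u} → u ∈ chain n → deg u ≤ n
  deg-≤ u∈ with ∈-chain⁻ u∈
  ... | k , k<n , refl = subst (_≤ n) (sym (deg-xᵏ (suc k))) k<n

  closed : ∀ {u w} → u ∈ chain n → w ∣ᵐ u → 0 < deg w → w ∈ chain n
  closed u∈ w∣u _ with ∈-chain⁻ u∈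
  closed {w = suc i ∷ []} _ (s≤s i≤k ∷ []) _ | k , k<n , refl = ∈-chain⁺ (≤-<-trans i≤k k<n)

  extension : ∀ {u} → u ∈ chain n → deg u < n → ∃[ w ] w ∈ chain n × u ∣ᵐ w × w ≢ u
  extension u∈ deg-u<n with ∈-chain⁻ u∈
  ... | k , _ , refl = xᵏ (suc (suc k)) , ∈-chain⁺ (subst (_< n) (deg-xᵏ (suc k)) deg-u<n) ,
                       n≤1+n (suc k) ∷ [] , 1+n≢n ∘ ∷-injectiveˡ

yᵉxᵏ : ℕ → ℕ → Monomial 2
yᵉxᵏ e k = e ∷ k ∷ []

deg-yᵉxᵏ : ∀ e k → deg (yᵉxᵏ e k) ≡ e + k
deg-yᵉxᵏ e k = cong (e +_) (+-identityʳ k)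

-- The nonconstant divisors of xᵐy: the powers xᵏ, 0 < k ≤ m, and the products xᵏy, k ≤ m.
fork : ℕ → List (Monomial 2)
fork m = map (yᵉxᵏ 0 ∘ suc) (upTo m) ++ map (yᵉxᵏ 1) (upTo (suc m))

∈-forkˣ : ∀ {m k} → k < m → yᵉxᵏ 0 (suc k) ∈ fork m
∈-forkˣ k<m = ∈-++⁺ˡ (∈-map⁺ (yᵉxᵏ 0 ∘ suc) (∈-upTo⁺ k<m))

∈-forkʸ : ∀ {m k} → k ≤ m → yᵉxᵏ 1 k ∈ fork m
∈-forkʸ {m} k≤m = ∈-++⁺ʳ (map (yᵉxᵏ 0 ∘ suc) (upTo m)) (∈-map⁺ (yᵉxᵏ 1) (∈-upTo⁺ (s≤s k≤m)))

∈-fork⁻ : ∀ {m u} → u ∈ fork m → (∃[ k ] k < m × u ≡ yᵉxᵏ 0 (suc k)) ⊎ (∃[ k ] k ≤ m × u ≡ yᵉxᵏ 1 k)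
∈-fork⁻ {m} u∈ with ∈-++⁻ (map (yᵉxᵏ 0 ∘ suc) (upTo m)) u∈
... | inj₁ u∈ˣ with ∈-map⁻ (yᵉxᵏ 0 ∘ suc) u∈ˣ
...   | k , k∈ , u≡ = inj₁ (k , ∈-upTo⁻ k∈ , u≡)
∈-fork⁻ {m} u∈ | inj₂ u∈ʸ with ∈-map⁻ (yᵉxᵏ 1) u∈ʸ
...   | k , k∈ , u≡ = inj₂ (k , s≤s⁻¹ (∈-upTo⁻ k∈) , u≡)

countDeg-fork : ∀ m j → countDeg (fork m) (suc j) ≡
                occurrences (suc j) (map suc (upTo m)) + occurrences (suc j) (map suc (upTo (suc m)))
countDeg-fork m j = trans (countDeg-++ (map (yᵉxᵏ 0 ∘ suc) (upTo m)) (map (yᵉxᵏ 1) (upTo (suc m))) (suc j))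
  (cong₂ _+_ (countDeg-map-upTo (yᵉxᵏ 0 ∘ suc) (deg-yᵉxᵏ 0 ∘ suc) m (suc j))
             (countDeg-map-upTo (yᵉxᵏ 1) (deg-yᵉxᵏ 1) (suc m) (suc j)))

countDeg-fork-< : ∀ {m j} → j < m → countDeg (fork m) (suc j) ≡ 2
countDeg-fork-< {m} {j} j<m =
  trans (countDeg-fork m j) (cong₂ _+_ (occurrences-1⋯n j<m) (occurrences-1⋯n (m<n⇒m<1+n j<m)))

countDeg-fork-top : ∀ m → countDeg (fork m) (suc m) ≡ 1
countDeg-fork-top m =
  trans (countDeg-fork m m) (cong₂ _+_ (occurrences-1⋯n-beyond {m} ≤-refl) (occurrences-1⋯n (n<1+n m)))

fork-isPuncturedPureIdeal : ∀ m → IsPuncturedPureIdeal (suc m) (fork m)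
fork-isPuncturedPureIdeal m = record
  { unique = ++⁺ (map⁺ (suc-injective ∘ ∷-injectiveˡ ∘ ∷-injectiveʳ) (upTo⁺ m))
                 (map⁺ (∷-injectiveˡ ∘ ∷-injectiveʳ) (upTo⁺ (suc m))) disjoint
  ; deg-pos = deg-pos
  ; deg-≤ = deg-≤
  ; closed = closed
  ; extension = extension
  }
  where
  disjoint : ∀ {w} → ¬ (w ∈ map (yᵉxᵏ 0 ∘ suc) (upTo m) × w ∈ map (yᵉxᵏ 1) (upTo (suc m)))
  disjoint (w∈ˣ , w∈ʸ) with ∈-map⁻ (yᵉxᵏ 0 ∘ suc) w∈ˣ | ∈-map⁻ (yᵉxᵏ 1) w∈ʸ
  ... | _ , _ , refl | _ , _ , ()

  deg-pos : ∀ {u} → u ∈ fork m → 0 < deg u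
  deg-pos u∈ with ∈-fork⁻ u∈
  ... | inj₁ (_ , _ , refl) = s≤s z≤n
  ... | inj₂ (_ , _ , refl) = s≤s z≤n

  deg-≤ : ∀ {u} → u ∈ fork m → deg u ≤ suc m
  deg-≤ u∈ with ∈-fork⁻ u∈
  ... | inj₁ (k , k<m , refl) = subst (_≤ suc m) (sym (deg-yᵉxᵏ 0 (suc k))) (m≤n⇒m≤1+n k<m)
  ... | inj₂ (k , k≤m , refl) = subst (_≤ suc m) (sym (deg-yᵉxᵏ 1 k)) (s≤s k≤m)

  closed : ∀ {u w} → u ∈ fork m → w ∣ᵐ u → 0 < deg w → w ∈ fork m
  closed u∈ w∣u _ with ∈-fork⁻ u∈
  closed {w = 0 ∷ suc i ∷ []} _ (_ ∷ s≤s i≤k ∷ []) _ | inj₁ (k , k<m , refl) = ∈-forkˣ (≤-<-trans i≤k k<m)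
  closed {w = 0 ∷ suc i ∷ []} _ (z≤n ∷ i<k ∷ []) _ | inj₂ (k , k≤m , refl) = ∈-forkˣ (<-≤-trans i<k k≤m)
  closed {w = 1 ∷ i ∷ []} _ (s≤s z≤n ∷ i≤k ∷ []) _ | inj₂ (k , k≤m , refl) = ∈-forkʸ (≤-trans i≤k k≤m)

  extension : ∀ {u} → u ∈ fork m → deg u < suc m → ∃[ w ] w ∈ fork m × u ∣ᵐ w × w ≢ u
  extension u∈ deg-u<1+m with ∈-fork⁻ u∈
  ... | inj₁ (k , k<m , refl) = yᵉxᵏ 1 (suc k) , ∈-forkʸ k<m , z≤n ∷ ≤-refl ∷ [] , λ ()
  ... | inj₂ (k , k≤m , refl) = yᵉxᵏ 1 (suc k) , ∈-forkʸ (subst (_≤ m) (deg-yᵉxᵏ 1 k) (s≤s⁻¹ deg-u<1+m)) ,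
                                ≤-refl ∷ n≤1+n k ∷ [] , 1+n≢n ∘ ∷-injectiveˡ ∘ ∷-injectiveʳ

applyUpTo-replicate-∷ʳ : ∀ {A : Set} (f : ℕ → A) {a b} m → (∀ j → j < m → f j ≡ a) → f m ≡ b →
                         applyUpTo f (suc m) ≡ replicate m a ++ (b ∷ [])
applyUpTo-replicate-∷ʳ f zero below top = cong (_∷ []) top
applyUpTo-replicate-∷ʳ f (suc m) below top =
  cong₂ _∷_ (below 0 (s≤s z≤n)) (applyUpTo-replicate-∷ʳ (f ∘ suc) m (λ j j<m → below (suc j) (s≤s j<m)) top)

isPureOSequence-2c+d : ∀ m c d → 0 < c + d → IsPureOSequence (1 ∷ (replicate m (2 * c + d) ++ (c + d ∷ [])))
isPureOSequence-2c+d m c d 0<c+d =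
  subst (IsPureOSequence ∘ (1 ∷_)) (applyUpTo-replicate-∷ʳ (countDeg N ∘ suc) m below top)
    (isPureOSequence-𝟙∷ P (subst (0 <_) (sym top) 0<c+d))
  where
  N : List (Monomial (c * 2 + d * 1))
  N = wedge (copies c (fork m)) (copies d (chain (suc m)))

  P : IsPuncturedPureIdeal (suc m) N
  P = wedge-isPuncturedPureIdeal (copies-isPuncturedPureIdeal c (fork-isPuncturedPureIdeal m))
                                 (copies-isPuncturedPureIdeal d (chain-isPuncturedPureIdeal (suc m)))

  countDeg-N : ∀ i → countDeg N i ≡ c * countDeg (fork m) i + d * countDeg (chain (suc m)) i
  countDeg-N i = trans (countDeg-wedge (copies c (fork m)) (copies d (chain (suc m))) i)
                       (cong₂ _+_ (countDeg-copies c (fork m) i) (countDeg-copies d (chain (suc m)) i))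

  below : ∀ j → j < m → countDeg N (suc j) ≡ 2 * c + d
  below j j<m = begin
    countDeg N (suc j)                                               ≡⟨ countDeg-N (suc j) ⟩
    c * countDeg (fork m) (suc j) + d * countDeg (chain (suc m)) (suc j)
      ≡⟨ cong₂ (λ x y → c * x + d * y) (countDeg-fork-< j<m) (countDeg-chain (m<n⇒m<1+n j<m)) ⟩
    c * 2 + d * 1                                                    ≡⟨ cong₂ _+_ (*-comm c 2) (*-identityʳ d) ⟩
    2 * c + d                                                        ∎
    where open ≡-Reasoning

  top : countDeg N (suc m) ≡ c + d
  top = begin
    countDeg N (suc m)                                               ≡⟨ countDeg-N (suc m) ⟩
    c * countDeg (fork m) (suc m) + d * countDeg (chain (suc m)) (suc m)
      ≡⟨ cong₂ (λ x y → c * x + d * y) (countDeg-fork-top m) (countDeg-chain (n<1+n m)) ⟩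
    c * 1 + d * 1                                                    ≡⟨ cong₂ _+_ (*-identityʳ c) (*-identityʳ d) ⟩
    c + d                                                            ∎
    where open ≡-Reasoning

⌈a/2⌉≤b≤a⇒2c+d≡a×c+d≡b : ∀ {a b} → ⌈ a /2⌉ ≤ b → b ≤ a → ∃₂ λ c d → 2 * c + d ≡ a × c + d ≡ b
⌈a/2⌉≤b≤a⇒2c+d≡a×c+d≡b {a} {b} ⌈a/2⌉≤b b≤a = c , d , 2c+d≡a , c+d≡b
  where
  c d : ℕ
  c = a ∸ b
  d = b ∸ c

  a≤b+b : a ≤ b + b
  a≤b+b = begin
    a                     ≡⟨ ⌊n/2⌋+⌈n/2⌉≡n a ⟨
    ⌊ a /2⌋ + ⌈ a /2⌉     ≤⟨ +-monoˡ-≤ ⌈ a /2⌉ (⌊n/2⌋≤⌈n/2⌉ a) ⟩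
    ⌈ a /2⌉ + ⌈ a /2⌉     ≤⟨ +-mono-≤ ⌈a/2⌉≤b ⌈a/2⌉≤b ⟩
    b + b                 ∎
    where open ≤-Reasoning

  c+d≡b : c + d ≡ b
  c+d≡b = m+[n∸m]≡n (m≤n+o⇒m∸n≤o a b a≤b+b)

  2c+d≡a : 2 * c + d ≡ a
  2c+d≡a = begin
    2 * c + d     ≡⟨ cong (λ x → c + x + d) (+-identityʳ c) ⟩
    c + c + d     ≡⟨ +-assoc c c d ⟩
    c + (c + d)   ≡⟨ cong (c +_) c+d≡b ⟩
    c + b         ≡⟨ m∸n+n≡m b≤a ⟩
    a             ∎
    where open ≡-Reasoning

lemma1p2 : (n a b : ℕ) → 2 ≤ n → 0 < a → ⌈ a /2⌉ ≤ b → b ≤ a →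
    IsPureOSequence (1 ∷ (replicate (n ∸ 1) a ++ (b ∷ [])))
lemma1p2 n a b _ 0<a ⌈a/2⌉≤b b≤a
  with ⌈a/2⌉≤b≤a⇒2c+d≡a×c+d≡b ⌈a/2⌉≤b b≤a | ≤-trans (⌈n/2⌉-mono 0<a) ⌈a/2⌉≤b
... | c , d , refl , refl | 0<c+d = isPureOSequence-2c+d (n ∸ 1) c d 0<c+d
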